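{- Let $\Gamma$ be a strongly regular graph of type II with parameters $(v,k,\lambda,\mu)$ and restricted eigenvalues $\rho>\sigma$, and let $h_0=v\frac{ -\sigma}{k-\sigma}$. If $\mu<k$, then $[x_{\lfloor h_0\rfloor}]=[x_{h_0}]$, where $x_y$ is taken with $d=0$.
   Context: A graph is strongly regular with parameters $(v,k,\lambda,\mu)$ if it has $v$ vertices, is $k$-regular, is neither complete nor edgeless, every two adjacent vertices have exactly $\lambda$ common neighbours, and every two distinct non-adjacent vertices have exactly $\mu$ common neighbours. Its restricted eigenvalues $\rho>\sigma$ are the roots of $t^2-(\lambda-\mu)t-(k-\mu)=0$; it is of type II if all its eigenvalues are integers. For $y<v$ and integer $d$, $x_y=\frac{2y(k-d)-(v-y)}{2(v-y)}$. For real $x$, $[x]=\lceil x-1/2\rceil$. -}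

module Defs where

open import Data.Bool using (Bool; true; false; if_then_else_; _∧_)
open import Data.Nat as ℕ using (ℕ)
open import Data.Integer as ℤ using (ℤ; +_)
open import Data.Rational as ℚ using (ℚ; 0ℚ; 1ℚ; _÷_; _-_; _+_; _*_; floor; ceiling; ≢-nonZero)
import Data.Rational as Q
open import Data.Rational.Properties using (_≟_)
open import Data.Fin using (Fin)
open import Data.List using (List; map; allFin)
open import Data.Nat.ListAction using (sum)
fromℤ : ℤ → ℚ
fromℤ z = z Q./ 1

open import Data.Product using (Σ; ∃; _×_)
open import Relation.Binary.PropositionalEquality using (_≡_; _≢_)
open import Relation.Nullary using (yes; no; ¬_)

Graph : ℕ → Set
Graph v = Fin v → Fin v → Bool

IsSimple : ∀ {v} → Graph v → Set
IsSimple {v} A = (∀ i → A i i ≡ false) × (∀ i j → A i j ≡ A j i)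

countB : ∀ {v} → (Fin v → Bool) → ℕ
countB {v} P = sum (map (λ j → if P j then 1 else 0) (allFin v))

degree : ∀ {v} → Graph v → Fin v → ℕ
degree A i = countB (λ j → A i j)

commonNbrs : ∀ {v} → Graph v → Fin v → Fin v → ℕ
commonNbrs A i j = countB (λ l → A i l ∧ A j l)

record IsSRG (v k lam μ : ℕ) (A : Graph v) : Set where
  field
    simple       : IsSimple A
    regular      : ∀ i → degree A i ≡ k
    notComplete  : ∃ λ i → ∃ λ j → i ≢ j × A i j ≡ false
    notEdgeless  : ∃ λ i → ∃ λ j → A i j ≡ true
    adjCommon    : ∀ i j → A i j ≡ true → commonNbrs A i j ≡ lam
    nonadjCommon : ∀ i j → i ≢ j → A i j ≡ false → commonNbrs A i j ≡ μ

IsRestrictedRoot : (k lam μ : ℕ) → ℤ → Set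
IsRestrictedRoot k lam μ t =
  t ℤ.* t ℤ.- (+ lam ℤ.- + μ) ℤ.* t ℤ.- (+ k ℤ.- + μ) ≡ + 0

-- total division on ℚ (value 0 when dividing by 0; never used in that case here)
_/₀_ : ℚ → ℚ → ℚ
p /₀ q with q ≟ 0ℚ
... | yes _  = 0ℚ
... | no q≢0 = _÷_ p q {{≢-nonZero q≢0}}

xval : (v : ℕ) (k d : ℤ) (y : ℚ) → ℚ
xval v k d y =
  (fromℤ (+ 2) * y * fromℤ (k ℤ.- d) - (fromℤ (+ v) - y))
    /₀ (fromℤ (+ 2) * (fromℤ (+ v) - y))

round : ℚ → ℤ
round x = ceiling (x - (1ℚ /₀ fromℤ (+ 2)))

h0 : (v k : ℕ) (σ : ℤ) → ℚ
h0 v k σ = fromℤ (+ v ℤ.* ℤ.- σ) /₀ fromℤ (+ k ℤ.- σ)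

module Submission where

-- Vieta's formulas give ρ + σ = λ − μ and ρσ = μ − k < 0, so ρ = q + 1 and σ = −(t + 1) with
-- k = (q + 1)(t + 1) + μ, i.e. k − λ − 1 = (q + 2)t.  Counting walks of length two from a vertex
-- gives k(k − λ − 1) = μ(v − k − 1), and μ(v − k − 1) = (q + 2)tk forces (k + t)² < vk.
-- After clearing the positive denominator 2(v − y), [x_y] = t holds exactly when tv < y(k + t) and
-- y(k + t + 1) ≤ (t + 1)v.  At y = h₀ = v(t + 1)/(k + t + 1) the second condition is an equality;
-- at y = ⌊h₀⌋ it persists, and the first one follows from (k + t)² < vk since h₀ − ⌊h₀⌋ < 1.

open import Defs
open import Data.Nat as ℕ using (ℕ)

module WalkCounting where

  open import Data.Bool using (Bool; true; false; if_then_else_; _∧_; not)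
  open import Data.Bool.Properties using (∧-idem)
  open import Data.Fin using (Fin; zero; suc; _≟_)
  open import Data.List using (tabulate; _∷_; [])
  open import Data.List.Properties using (map-tabulate)
  open import Data.Nat.ListAction as List using ()
  open import Data.Nat using (ℕ; zero; suc; _+_; _*_)
  open import Data.Nat.Properties hiding (_≟_)
  open import Algebra.Properties.Semiring.Sum +-*-semiring
    using (sum; sum-syntax; sum-cong-≗; ∑-comm; ∑-distrib-+; *-distribˡ-sum; *-distribʳ-sum)
  open import Data.Product using (proj₁; proj₂)
  open import Function using (_∘_; id)
  open import Relation.Nullary using (does; yes; no)
  open import Relation.Binary.PropositionalEquality
  open import Data.Nat.Tactic.RingSolver using (solve)

  χ : Bool → ℕ
  χ b = if b then 1 else 0

  χ-∧ : ∀ a b → χ (a ∧ b) ≡ χ a * χ b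
  χ-∧ false b = refl
  χ-∧ true b = sym (+-identityʳ (χ b))

  ∑-tabulate : ∀ {n} (f : Fin n → ℕ) → List.sum (tabulate f) ≡ ∑[ j < n ] f j
  ∑-tabulate {zero} f = refl
  ∑-tabulate {suc n} f = cong (f zero +_) (∑-tabulate (f ∘ suc))

  countB≡∑ : ∀ {n} (P : Fin n → Bool) → countB P ≡ ∑[ j < n ] χ (P j)
  countB≡∑ P = trans (cong List.sum (map-tabulate id (χ ∘ P))) (∑-tabulate (χ ∘ P))

  ∑-const : ∀ n c → ∑[ _ < n ] c ≡ n * c
  ∑-const zero c = refl
  ∑-const (suc n) c = cong (c +_) (∑-const n c)

  ∑-δ : ∀ {n} (i : Fin n) → ∑[ l < n ] χ (does (l ≟ i)) ≡ 1
  ∑-δ {suc n} zero = cong suc (trans (∑-const n 0) (*-zeroʳ n))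
  ∑-δ {suc n} (suc i) = ∑-δ i

  module Neighbourhood {v k lam μ : ℕ} {A : Graph v} (srg : IsSRG v k lam μ A) (i : Fin v) where
    open IsSRG srg

    adjacent self far : Fin v → ℕ
    adjacent l = χ (A i l)
    self l = χ (does (l ≟ i))
    far l = χ (not (A i l) ∧ not (does (l ≟ i)))

    adjacent+self+far≡1 : ∀ l → adjacent l + self l + far l ≡ 1
    adjacent+self+far≡1 l with l ≟ i
    ... | yes refl rewrite proj₁ simple l = refl
    ... | no _ with A i l
    ...   | true = refl
    ...   | false = refl

    degree≡∑ : ∀ j → ∑[ l < v ] χ (A j l) ≡ k
    degree≡∑ j = trans (sym (countB≡∑ (A j))) (regular j)

    commonNbrs-self : commonNbrs A i i ≡ k
    commonNbrs-self = begin
      commonNbrs A i i                  ≡⟨ countB≡∑ (λ l → A i l ∧ A i l) ⟩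
      ∑[ l < v ] χ (A i l ∧ A i l)      ≡⟨ sum-cong-≗ (λ l → cong χ (∧-idem (A i l))) ⟩
      ∑[ l < v ] χ (A i l)              ≡⟨ degree≡∑ i ⟩
      k                                 ∎
      where open ≡-Reasoning

    -- Row i of A² = kI + λA + μ(J − I − A).
    commonNbrs-split : ∀ l → commonNbrs A i l ≡ lam * adjacent l + k * self l + μ * far l
    commonNbrs-split l with l ≟ i
    ... | yes refl rewrite proj₁ simple l = trans commonNbrs-self (solve (lam ∷ k ∷ μ ∷ []))
    ... | no l≢i with A i l in Ail
    ...   | true  = trans (adjCommon i l Ail) (solve (lam ∷ k ∷ μ ∷ []))
    ...   | false = trans (nonadjCommon i l (l≢i ∘ sym) Ail) (solve (lam ∷ k ∷ μ ∷ []))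

    ∑-commonNbrs≡k² : ∑[ l < v ] commonNbrs A i l ≡ k * k
    ∑-commonNbrs≡k² = begin
      ∑[ l < v ] commonNbrs A i l                          ≡⟨ sum-cong-≗ (λ l → countB≡∑ (λ j → A i j ∧ A l j)) ⟩
      ∑[ l < v ] ∑[ j < v ] χ (A i j ∧ A l j)              ≡⟨ sum-cong-≗ (λ l → sum-cong-≗ (λ j → step l j)) ⟩
      ∑[ l < v ] ∑[ j < v ] (χ (A i j) * χ (A j l))        ≡⟨ ∑-comm (λ l j → χ (A i j) * χ (A j l)) ⟩
      ∑[ j < v ] ∑[ l < v ] (χ (A i j) * χ (A j l))        ≡⟨ sum-cong-≗ (λ j → sym (*-distribˡ-sum (χ (A i j)) (χ ∘ A j))) ⟩
      ∑[ j < v ] (χ (A i j) * ∑[ l < v ] χ (A j l))        ≡⟨ sum-cong-≗ (λ j → cong (χ (A i j) *_) (degree≡∑ j)) ⟩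
      ∑[ j < v ] (χ (A i j) * k)                           ≡⟨ sym (*-distribʳ-sum k (χ ∘ A i)) ⟩
      ∑[ j < v ] χ (A i j) * k                             ≡⟨ cong (_* k) (degree≡∑ i) ⟩
      k * k                                                ∎
      where
      open ≡-Reasoning
      step : ∀ l j → χ (A i j ∧ A l j) ≡ χ (A i j) * χ (A j l)
      step l j = trans (χ-∧ (A i j) (A l j)) (cong (λ b → χ (A i j) * χ b) (proj₂ simple l j))

    farCount : ℕ
    farCount = ∑[ l < v ] far l

    ∑-adjacent-self-far : ∀ (a b c : ℕ) → ∑[ l < v ] (a * adjacent l + b * self l + c * far l) ≡ a * k + b + c * farCount
    ∑-adjacent-self-far a b c = begin
      ∑[ l < v ] (a * adjacent l + b * self l + c * far l)
        ≡⟨ ∑-distrib-+ (λ l → a * adjacent l + b * self l) (λ l → c * far l) ⟩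
      ∑[ l < v ] (a * adjacent l + b * self l) + ∑[ l < v ] (c * far l)
        ≡⟨ cong (_+ ∑[ l < v ] (c * far l)) (∑-distrib-+ (λ l → a * adjacent l) (λ l → b * self l)) ⟩
      ∑[ l < v ] (a * adjacent l) + ∑[ l < v ] (b * self l) + ∑[ l < v ] (c * far l)
        ≡⟨ sym (cong₂ _+_ (cong₂ _+_ (*-distribˡ-sum a adjacent) (*-distribˡ-sum b self)) (*-distribˡ-sum c far)) ⟩
      a * ∑[ l < v ] adjacent l + b * ∑[ l < v ] self l + c * farCount
        ≡⟨ cong₂ (λ x y → a * x + b * y + c * farCount) (degree≡∑ i) (∑-δ i) ⟩
      a * k + b * 1 + c * farCount
        ≡⟨ cong (λ x → a * k + x + c * farCount) (*-identityʳ b) ⟩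
      a * k + b + c * farCount ∎
      where open ≡-Reasoning

    vertexCount : v ≡ k + suc farCount
    vertexCount = begin
      v                                        ≡⟨ sym (trans (∑-const v 1) (*-identityʳ v)) ⟩
      ∑[ l < v ] 1                             ≡⟨ sum-cong-≗ (λ l → sym (trans (ones l) (adjacent+self+far≡1 l))) ⟩
      ∑[ l < v ] (1 * adjacent l + 1 * self l + 1 * far l) ≡⟨ ∑-adjacent-self-far 1 1 1 ⟩
      1 * k + 1 + 1 * farCount                 ≡⟨ cong₂ (λ x y → x + 1 + y) (*-identityˡ k) (*-identityˡ farCount) ⟩
      k + 1 + farCount                         ≡⟨ +-assoc k 1 farCount ⟩
      k + suc farCount                         ∎
      where
      open ≡-Reasoning
      ones : ∀ l → 1 * adjacent l + 1 * self l + 1 * far l ≡ adjacent l + self l + far l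
      ones l = cong₂ _+_ (cong₂ _+_ (*-identityˡ (adjacent l)) (*-identityˡ (self l))) (*-identityˡ (far l))

    walkCount : k * k ≡ lam * k + k + μ * farCount
    walkCount = trans (sym ∑-commonNbrs≡k²) (trans (sum-cong-≗ commonNbrs-split) (∑-adjacent-self-far lam k μ))

module Eigenvalues where

  open import Data.Nat as ℕ using (suc)
  open import Data.Integer as ℤ using (+_; -[1+_]; +[1+_]; _+_; _-_; _*_; -_; 0ℤ)
  open import Data.Integer.Properties
  open import Data.Integer.Tactic.RingSolver using (solve)
  open import Data.List using (_∷_; [])
  open import Data.Product using (∃₂; _×_; _,_)
  open import Data.Sum using (inj₁; inj₂)
  open import Relation.Nullary using (contradiction)
  open import Relation.Binary.PropositionalEquality

  vieta : ∀ {e c ρ σ} → ρ * ρ - e * ρ - c ≡ 0ℤ → σ * σ - e * σ - c ≡ 0ℤ → ρ ≢ σ →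
          ρ + σ ≡ e × ρ * σ ≡ - c
  vieta {e} {c} {ρ} {σ} fρ fσ ρ≢σ = i-j≡0⇒i≡j (ρ + σ) e ρ+σ-e≡0 , product≡
    where
    open ≡-Reasoning
    ρ+σ-e≡0 : ρ + σ - e ≡ 0ℤ
    ρ+σ-e≡0 with i*j≡0⇒i≡0∨j≡0 (ρ - σ) (begin
        (ρ - σ) * (ρ + σ - e)                    ≡⟨ solve (ρ ∷ σ ∷ e ∷ c ∷ []) ⟩
        (ρ * ρ - e * ρ - c) - (σ * σ - e * σ - c) ≡⟨ cong₂ _-_ fρ fσ ⟩
        0ℤ                                        ∎)
    ... | inj₁ ρ-σ≡0 = contradiction (i-j≡0⇒i≡j ρ σ ρ-σ≡0) ρ≢σ
    ... | inj₂ ρ+σ-e≡0 = ρ+σ-e≡0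
    product≡ : ρ * σ ≡ - c
    product≡ = begin
      ρ * σ                                       ≡⟨ solve (ρ ∷ σ ∷ e ∷ c ∷ []) ⟩
      ρ * (ρ + σ - e) - (ρ * ρ - e * ρ - c) - c   ≡⟨ cong₂ (λ a b → ρ * a - b - c) ρ+σ-e≡0 fρ ⟩
      ρ * 0ℤ - 0ℤ - c                             ≡⟨ solve (ρ ∷ c ∷ []) ⟩
      - c                                         ∎

  opposite-signs : ∀ {ρ σ} → ρ * σ ℤ.< 0ℤ → σ ℤ.< ρ → ∃₂ λ q t → ρ ≡ +[1+ q ] × σ ≡ -[1+ t ]
  opposite-signs {+[1+ q ]} { -[1+ t ]} _ _ = q , t , refl , refl
  opposite-signs {+[1+ q ]} {+ 0} ρσ<0 _ = contradiction (subst (ℤ._< 0ℤ) (*-zeroʳ +[1+ q ]) ρσ<0) (<-irrefl refl)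
  opposite-signs {+[1+ q ]} {+[1+ t ]} (ℤ.+<+ ()) _
  opposite-signs {+ 0} {σ} (ℤ.+<+ ()) _
  opposite-signs { -[1+ q ]} { -[1+ t ]} (ℤ.+<+ ()) _
  opposite-signs { -[1+ q ]} {+ _} _ ()

  m<n⇒-[n-m]<0 : ∀ {m n} → m ℕ.< n → - (+ n - + m) ℤ.< 0ℤ
  m<n⇒-[n-m]<0 {m} {n} m<n = neg-mono-< (subst (ℤ._< + n - + m) (+-inverseʳ (+ m)) (+-monoˡ-< (- + m) (ℤ.+<+ m<n)))

  restricted-parameters : ∀ {k lam μ ρ σ} → IsRestrictedRoot k lam μ ρ → IsRestrictedRoot k lam μ σ →
    σ ℤ.< ρ → μ ℕ.< k →
    ∃₂ λ q t → σ ≡ -[1+ t ] × k ≡ suc q ℕ.* suc t ℕ.+ μ × lam ℕ.+ suc t ≡ suc q ℕ.+ μ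
  restricted-parameters {k} {lam} {μ} {ρ} {σ} fρ fσ σ<ρ μ<k
    with vieta {+ lam - + μ} {+ k - + μ} fρ fσ (≢-sym (<⇒≢ σ<ρ))
  ... | ρ+σ≡ , ρσ≡ with opposite-signs (subst (ℤ._< 0ℤ) (sym ρσ≡) (m<n⇒-[n-m]<0 μ<k)) σ<ρ
  ... | q , t , refl , refl = q , t , refl ,
    sym (+-injective (*-transpose +[1+ q ] -[1+ t ] (+ k) (+ μ) ρσ≡)) ,
    sym (+-injective (+-transpose +[1+ q ] -[1+ t ] (+ lam) (+ μ) ρ+σ≡))
    where
    open ≡-Reasoning
    +-transpose : ∀ x y a b → x + y ≡ a - b → x + b ≡ a - y
    +-transpose x y a b eq = begin
      x + b          ≡⟨ solve (x ∷ y ∷ b ∷ []) ⟩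
      (x + y) - y + b ≡⟨ cong (λ z → z - y + b) eq ⟩
      (a - b) - y + b ≡⟨ solve (a ∷ b ∷ y ∷ []) ⟩
      a - y          ∎
    *-transpose : ∀ x y a b → x * y ≡ - (a - b) → x * - y + b ≡ a
    *-transpose x y a b eq = begin
      x * - y + b     ≡⟨ solve (x ∷ y ∷ b ∷ []) ⟩
      - (x * y) + b   ≡⟨ cong (λ z → - z + b) eq ⟩
      - - (a - b) + b ≡⟨ solve (a ∷ b ∷ []) ⟩
      a               ∎

module Arithmetic where

  open import Data.Nat
  open import Data.Nat.Properties
  open import Data.Nat.Tactic.RingSolver using (solve)
  open import Data.List using (_∷_; [])
  open import Data.Product using (_×_; _,_)
  open import Relation.Binary.PropositionalEquality

  k≡λ+1+[2+q]t : ∀ {k lam μ} q t → k ≡ suc q * suc t + μ → lam + suc t ≡ suc q + μ →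
                  k ≡ lam + suc ((2 + q) * t)
  k≡λ+1+[2+q]t {k} {lam} {μ} q t k≡ lam≡ = +-cancelˡ-≡ (suc t) k (lam + suc ((2 + q) * t)) (begin
    suc t + k                         ≡⟨ cong (suc t +_) k≡ ⟩
    suc t + (suc q * suc t + μ)       ≡⟨ solve (t ∷ q ∷ μ ∷ []) ⟩
    suc q + μ + suc ((2 + q) * t)     ≡⟨ cong (_+ suc ((2 + q) * t)) lam≡ ⟨
    lam + suc t + suc ((2 + q) * t)   ≡⟨ solve (lam ∷ t ∷ q ∷ []) ⟩
    suc t + (lam + suc ((2 + q) * t)) ∎)
    where open ≡-Reasoning

  μc≡ak : ∀ {k lam} μ a c → k * k ≡ lam * k + k + μ * c → k ≡ lam + suc a → μ * c ≡ a * k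
  μc≡ak {k} {lam} μ a c walks k≡ = +-cancelˡ-≡ (lam * k + k) (μ * c) (a * k) (begin
    lam * k + k + μ * c   ≡⟨ walks ⟨
    k * k                 ≡⟨ cong (_* k) k≡ ⟩
    (lam + suc a) * k     ≡⟨ solve (lam ∷ a ∷ k ∷ []) ⟩
    lam * k + k + a * k   ∎)
    where open ≡-Reasoning

  μ+t<[1+q][1+t]+μ : ∀ μ q t → μ + t < suc q * suc t + μ
  μ+t<[1+q][1+t]+μ μ q t = begin-strict
    μ + t               ≡⟨ +-comm μ t ⟩
    t + μ               <⟨ n<1+n (t + μ) ⟩
    suc t + μ           ≤⟨ +-monoˡ-≤ μ (m≤m+n (suc t) (q * suc t)) ⟩
    suc q * suc t + μ   ∎
    where open ≤-Reasoning

  μ[k+t]²<μ[k+1+c]k : ∀ {k} μ t q c → 0 < μ → μ + t < k → μ * c ≡ (2 + q) * t * k →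
                        μ * ((k + t) * (k + t)) < μ * ((k + suc c) * k)
  μ[k+t]²<μ[k+1+c]k {k} μ t q c 0<μ μ+t<k μc≡ = begin-strict
    μ * ((k + t) * (k + t))                       ≡⟨ solve (μ ∷ k ∷ t ∷ []) ⟩
    μ * (k * k) + t * (μ * (k + k + t))           ≤⟨ +-monoʳ-≤ (μ * (k * k)) (*-monoʳ-≤ t μ[2k+t]≤2k²) ⟩
    μ * (k * k) + t * ((k + k) * k)               <⟨ +-monoʳ-< (μ * (k * k)) t[2k²]<μk+ck ⟩
    μ * (k * k) + (μ * k + (2 + q) * t * k * k)   ≡⟨ cong (λ x → μ * (k * k) + (μ * k + x * k)) μc≡ ⟨
    μ * (k * k) + (μ * k + μ * c * k)             ≡⟨ solve (μ ∷ k ∷ c ∷ []) ⟩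
    μ * ((k + suc c) * k)                         ∎
    where
    open ≤-Reasoning
    μ+t≤k : μ + t ≤ k
    μ+t≤k = <⇒≤ μ+t<k
    μ≤k+k : μ ≤ k + k
    μ≤k+k = ≤-trans (≤-trans (m≤m+n μ t) μ+t≤k) (m≤m+n k k)
    μ[2k+t]≤2k² : μ * (k + k + t) ≤ (k + k) * k
    μ[2k+t]≤2k² = begin
      μ * (k + k + t)           ≡⟨ solve (μ ∷ k ∷ t ∷ []) ⟩
      (k + k) * μ + μ * t       ≤⟨ +-monoʳ-≤ ((k + k) * μ) (*-monoˡ-≤ t μ≤k+k) ⟩
      (k + k) * μ + (k + k) * t ≡⟨ *-distribˡ-+ (k + k) μ t ⟨
      (k + k) * (μ + t)         ≤⟨ *-monoʳ-≤ (k + k) μ+t≤k ⟩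
      (k + k) * k               ∎
    t[2k²]<μk+ck : t * ((k + k) * k) < μ * k + (2 + q) * t * k * k
    t[2k²]<μk+ck = begin-strict
      t * ((k + k) * k)           ≡⟨ solve (t ∷ k ∷ []) ⟩
      2 * t * k * k               ≤⟨ *-monoˡ-≤ k (*-monoˡ-≤ k (*-monoˡ-≤ t (m≤m+n 2 q))) ⟩
      (2 + q) * t * k * k         <⟨ m<n+m _ (*-mono-≤ 0<μ (≤-<-trans z≤n μ+t<k)) ⟩
      μ * k + (2 + q) * t * k * k ∎

  [k+t]²<[k+1+c]k : ∀ {k} μ t q c → μ + t < k → μ * c ≡ (2 + q) * t * k → (k + t) * (k + t) < (k + suc c) * k
  [k+t]²<[k+1+c]k {suc k} zero zero q c _ _ = begin-strict
    (suc k + 0) * (suc k + 0) ≡⟨ cong (λ x → x * x) (+-identityʳ (suc k)) ⟩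
    suc k * suc k             <⟨ *-monoˡ-< (suc k) (m<m+n (suc k) z<s) ⟩
    (suc k + suc c) * suc k   ∎
    where open ≤-Reasoning
  -- For μ = 0 the hypothesis μc ≡ (2 + q)(1 + t)k would read 0 ≡ suc _, so t = 0.
  [k+t]²<[k+1+c]k {suc k} zero (suc t) q c _ ()
  [k+t]²<[k+1+c]k μ@(suc _) t q c μ+t<k μc≡ = *-cancelˡ-< μ _ _ (μ[k+t]²<μ[k+1+c]k μ t q c z<s μ+t<k μc≡)

  quotient-bounds : ∀ {k t v} h r → (k + t) * (k + t) < v * k → r + h * (k + suc t) ≡ v * suc t → r < k + suc t →
                    h + r < v × t * v < h * (k + t)
  quotient-bounds {k} {t} {v} h r square<vk division r<m = h+r<v , +-cancelˡ-< (h + r) _ _ (begin-strict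
    h + r + t * v        <⟨ +-monoˡ-< (t * v) h+r<v ⟩
    v + t * v            ≡⟨ *-comm (suc t) v ⟩
    v * suc t            ≡⟨ division ⟨
    r + h * (k + suc t)  ≡⟨ solve (r ∷ h ∷ k ∷ t ∷ []) ⟩
    h + r + h * (k + t)  ∎)
    where
    open ≤-Reasoning
    r≤k+t : r ≤ k + t
    r≤k+t = ≤-pred (subst (r <_) (+-suc k t) r<m)
    h+r<v : h + r < v
    h+r<v = *-cancelˡ-< (k + suc t) _ _ (begin-strict
      (k + suc t) * (h + r)              ≡⟨ solve (k ∷ t ∷ h ∷ r ∷ []) ⟩
      r + h * (k + suc t) + r * (k + t)  ≡⟨ cong (_+ r * (k + t)) division ⟩
      v * suc t + r * (k + t)            ≤⟨ +-monoʳ-≤ (v * suc t) (*-monoˡ-≤ (k + t) r≤k+t) ⟩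
      v * suc t + (k + t) * (k + t)      <⟨ +-monoʳ-< (v * suc t) square<vk ⟩
      v * suc t + v * k                  ≡⟨ solve (v ∷ t ∷ k ∷ []) ⟩
      (k + suc t) * v                    ∎)

module Rationals where

  open import Data.Nat as ℕ using (ℕ; zero; suc)
  import Data.Nat.Properties as ℕ
  import Data.Nat.Coprimality as Coprimality
  open import Data.Integer as ℤ using (+_; -[1+_]; +[1+_])
  import Data.Integer.Properties as ℤ
  open import Data.Integer.DivMod using (div-pos-is-/ℕ; n<s[n/ℕd]*d; [n/d]*d≤n)
  open import Data.Rational as ℚ using (ℚ; mkℚ; 0ℚ; 1ℚ; _+_; _*_; _-_; -_; _≤_; _<_; *≤*; *<*; floor; ceiling)
  open import Data.Rational.Properties
  open import Data.List using (_∷_; [])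
  open import Data.Product using (_×_; _,_; proj₁; proj₂)
  open import Level using (0ℓ)
  open import Tactic.RingSolver using (solve)
  open import Tactic.RingSolver.Core.AlmostCommutativeRing using (AlmostCommutativeRing; fromCommutativeRing)
  open import Relation.Nullary using (yes; no; contradiction)
  open import Relation.Nullary.Decidable using (dec⇒maybe)
  open import Relation.Binary.PropositionalEquality

  ℚ-ring : AlmostCommutativeRing 0ℓ 0ℓ
  ℚ-ring = fromCommutativeRing +-*-commutativeRing (λ p → dec⇒maybe (0ℚ ≟ p))

  coprime-1 : ∀ n → Coprimality.Coprime n 1
  coprime-1 n = Coprimality.sym (Coprimality.1-coprimeTo n)

  fromℤ≡mkℚ : ∀ n → fromℤ n ≡ mkℚ n 0 (coprime-1 ℤ.∣ n ∣)
  fromℤ≡mkℚ (+ m)    = normalize-coprime (coprime-1 m)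
  fromℤ≡mkℚ -[1+ m ] = cong -_ (normalize-coprime (coprime-1 (suc m)))

  fromℤ-+ : ∀ a b → fromℤ (a ℤ.+ b) ≡ fromℤ a + fromℤ b
  fromℤ-+ a b rewrite fromℤ≡mkℚ a | fromℤ≡mkℚ b =
    cong fromℤ (sym (cong₂ ℤ._+_ (ℤ.*-identityʳ a) (ℤ.*-identityʳ b)))

  fromℤ-* : ∀ a b → fromℤ (a ℤ.* b) ≡ fromℤ a * fromℤ b
  fromℤ-* a b rewrite fromℤ≡mkℚ a | fromℤ≡mkℚ b = refl

  fromℤ-neg : ∀ a → fromℤ (ℤ.- a) ≡ - fromℤ a
  fromℤ-neg a rewrite fromℤ≡mkℚ (ℤ.- a) | fromℤ≡mkℚ a with a
  ... | + zero   = refl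
  ... | +[1+ _ ] = refl
  ... | -[1+ _ ] = refl

  fromℤ-mono-≤ : ∀ {a b} → a ℤ.≤ b → fromℤ a ≤ fromℤ b
  fromℤ-mono-≤ {a} {b} a≤b rewrite fromℤ≡mkℚ a | fromℤ≡mkℚ b =
    *≤* (subst₂ ℤ._≤_ (sym (ℤ.*-identityʳ a)) (sym (ℤ.*-identityʳ b)) a≤b)

  fromℤ-mono-< : ∀ {a b} → a ℤ.< b → fromℤ a < fromℤ b
  fromℤ-mono-< {a} {b} a<b rewrite fromℤ≡mkℚ a | fromℤ≡mkℚ b =
    *<* (subst₂ ℤ._<_ (sym (ℤ.*-identityʳ a)) (sym (ℤ.*-identityʳ b)) a<b)

  ⟦_⟧ : ℕ → ℚ
  ⟦ n ⟧ = fromℤ (+ n)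

  ⟦⟧-+ : ∀ m n → ⟦ m ℕ.+ n ⟧ ≡ ⟦ m ⟧ + ⟦ n ⟧
  ⟦⟧-+ m n = fromℤ-+ (+ m) (+ n)

  ⟦⟧-* : ∀ m n → ⟦ m ℕ.* n ⟧ ≡ ⟦ m ⟧ * ⟦ n ⟧
  ⟦⟧-* m n = trans (cong fromℤ (ℤ.pos-* m n)) (fromℤ-* (+ m) (+ n))

  ⟦⟧-mono-≤ : ∀ {m n} → m ℕ.≤ n → ⟦ m ⟧ ≤ ⟦ n ⟧
  ⟦⟧-mono-≤ m≤n = fromℤ-mono-≤ (ℤ.+≤+ m≤n)

  ⟦⟧-mono-< : ∀ {m n} → m ℕ.< n → ⟦ m ⟧ < ⟦ n ⟧
  ⟦⟧-mono-< m<n = fromℤ-mono-< (ℤ.+<+ m<n)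

  /-unique : ∀ {a n} d → n ℤ.* + suc d ℤ.≤ a → a ℤ.< ℤ.suc n ℤ.* + suc d → a ℤ./ + suc d ≡ n
  /-unique {a} {n} d nD≤a a<[1+n]D = ℤ.≤-antisym
    (below-suc (ℤ.*-cancelʳ-<-nonNeg D (ℤ.≤-<-trans ([n/d]*d≤n a D) a<[1+n]D)))
    (below-suc (ℤ.*-cancelʳ-<-nonNeg D (ℤ.≤-<-trans nD≤a a<[1+q]D)))
    where
    D = + suc d
    below-suc : ∀ {i j} → i ℤ.< ℤ.suc j → i ℤ.≤ j
    below-suc {i} {j} i<1+j = subst (i ℤ.≤_) (ℤ.pred-suc j) (ℤ.i<j⇒i≤pred[j] i<1+j)
    a<[1+q]D : a ℤ.< ℤ.suc (a ℤ./ D) ℤ.* D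
    a<[1+q]D = subst (λ q → a ℤ.< ℤ.suc q ℤ.* D) (sym (div-pos-is-/ℕ a (suc d))) (n<s[n/ℕd]*d a (suc d))

  floor-unique : ∀ n p → fromℤ n ≤ p → p < fromℤ (ℤ.suc n) → floor p ≡ n
  floor-unique n p@(mkℚ a d _) n≤p p<n+1 = /-unique d (lower n≤p) (upper p<n+1)
    where
    lower : fromℤ n ≤ p → n ℤ.* + suc d ℤ.≤ a
    lower n≤p with fromℤ n | fromℤ≡mkℚ n
    ... | _ | refl with n≤p
    ...   | *≤* le = subst (n ℤ.* + suc d ℤ.≤_) (ℤ.*-identityʳ a) le
    upper : p < fromℤ (ℤ.suc n) → a ℤ.< ℤ.suc n ℤ.* + suc d
    upper p<n+1 with fromℤ (ℤ.suc n) | fromℤ≡mkℚ (ℤ.suc n)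
    ... | _ | refl with p<n+1
    ...   | *<* lt = subst (ℤ._< ℤ.suc n ℤ.* + suc d) (ℤ.*-identityʳ a) lt

  ceiling-unique : ∀ n p → fromℤ n - 1ℚ < p → p ≤ fromℤ n → ceiling p ≡ n
  ceiling-unique n p@(mkℚ _ _ _) n-1<p p≤n = begin
    ℤ.- floor (- p)  ≡⟨ cong ℤ.-_ (floor-unique (ℤ.- n) (- p) -n≤-p -p<1-n) ⟩
    ℤ.- (ℤ.- n)      ≡⟨ ℤ.neg-involutive n ⟩
    n                ∎
    where
    open ≡-Reasoning
    -n≤-p : fromℤ (ℤ.- n) ≤ - p
    -n≤-p = subst (_≤ - p) (sym (fromℤ-neg n)) (neg-antimono-≤ p≤n)
    -p<1-n : - p < fromℤ (ℤ.suc (ℤ.- n))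
    -p<1-n = subst (- p <_) 1-n≡ (neg-antimono-< n-1<p)
      where
      neg-[x-1] : ∀ x → - (x - 1ℚ) ≡ 1ℚ + - x
      neg-[x-1] x = solve (x ∷ []) ℚ-ring
      1-n≡ : - (fromℤ n - 1ℚ) ≡ fromℤ (ℤ.suc (ℤ.- n))
      1-n≡ = begin
        - (fromℤ n - 1ℚ)   ≡⟨ neg-[x-1] (fromℤ n) ⟩
        1ℚ + - fromℤ n     ≡⟨ cong (λ x → 1ℚ + x) (fromℤ-neg n) ⟨
        1ℚ + fromℤ (ℤ.- n) ≡⟨ fromℤ-+ (+ 1) (ℤ.- n) ⟨
        fromℤ (ℤ.suc (ℤ.- n)) ∎

  /₀-*-cancel : ∀ p q → q ≢ 0ℚ → (p /₀ q) * q ≡ p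
  /₀-*-cancel p q q≢0 with q ≟ 0ℚ
  ... | yes q≡0 = contradiction q≡0 q≢0
  ... | no q≢0′ = begin
    p * ℚ.1/ q * q       ≡⟨ *-assoc p (ℚ.1/ q) q ⟩
    p * (ℚ.1/ q * q)     ≡⟨ cong (p *_) (*-inverseˡ q) ⟩
    p * 1ℚ               ≡⟨ *-identityʳ p ⟩
    p                    ∎
    where
    open ≡-Reasoning
    instance _ = ℚ.≢-nonZero q≢0′

  0≤q-p : ∀ {p q} → p ≤ q → 0ℚ ≤ q - p
  0≤q-p {p} {q} p≤q = subst₂ _≤_ (+-inverseʳ p) refl (+-monoˡ-≤ (- p) p≤q)

  0<q-p : ∀ {p q} → p < q → 0ℚ < q - p
  0<q-p {p} {q} p<q = subst₂ _<_ (+-inverseʳ p) refl (+-monoˡ-< (- p) p<q)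

  ≤-by-gap : ∀ {p q} d → 0ℚ ≤ d → q ≡ p + d → p ≤ q
  ≤-by-gap {p} d 0≤d refl = subst (_≤ p + d) (+-identityʳ p) (+-monoʳ-≤ p 0≤d)

  <-by-gap : ∀ {p q} d → 0ℚ < d → q ≡ p + d → p < q
  <-by-gap {p} d 0<d refl = subst (_< p + d) (+-identityʳ p) (+-monoʳ-< p 0<d)

  ½ : ℚ
  ½ = 1ℚ /₀ fromℤ (+ 2)

  xval-rounding-bounds : ∀ y K V T → y < V → T * V < y * (K + T) → y * (K + (1ℚ + T)) ≤ V * (1ℚ + T) →
    let X = (fromℤ (+ 2) * y * K - (V - y)) /₀ (fromℤ (+ 2) * (V - y)) in T - 1ℚ < X - ½ × X - ½ ≤ T
  xval-rounding-bounds y K V T y<V TV<y[K+T] y[K+1+T]≤V[1+T] =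
    *-cancelʳ-<-nonNeg D (<-by-gap (l + l) (+-mono-< 0<l 0<l) lower) ,
    *-cancelʳ-≤-pos D (≤-by-gap (u + u) (+-mono-≤ 0≤u 0≤u) upper)
    where
    D = fromℤ (+ 2) * (V - y)
    X = (fromℤ (+ 2) * y * K - (V - y)) /₀ D
    0<D : 0ℚ < D
    0<D = subst (0ℚ <_) (double (V - y)) (+-mono-< (0<q-p y<V) (0<q-p y<V))
      where
      double : ∀ x → x + x ≡ fromℤ (+ 2) * x
      double x = solve (x ∷ []) ℚ-ring
    instance
      _ : ℚ.Positive D
      _ = ℚ.positive 0<D
      _ : ℚ.NonNegative D
      _ = ℚ.nonNegative (<⇒≤ 0<D)
    -- Twice the slacks u, l of the hypotheses separate (X − ½)D from T·D and (T − 1)D.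
    u = V * (1ℚ + T) - y * (K + (1ℚ + T))
    0≤u : 0ℚ ≤ u
    0≤u = 0≤q-p y[K+1+T]≤V[1+T]
    l = y * (K + T) - T * V
    0<l : 0ℚ < l
    0<l = 0<q-p TV<y[K+T]
    open ≡-Reasoning
    half-shift : ∀ x Δ → (x - ½) * (fromℤ (+ 2) * Δ) ≡ x * (fromℤ (+ 2) * Δ) - Δ
    half-shift x Δ = solve (x ∷ Δ ∷ []) ℚ-ring
    shifted : (X - ½) * D ≡ fromℤ (+ 2) * y * K - (V - y) - (V - y)
    shifted = begin
      (X - ½) * D                                ≡⟨ half-shift X (V - y) ⟩
      X * D - (V - y)                            ≡⟨ cong (_- (V - y)) (/₀-*-cancel _ D (≢-sym (<⇒≢ 0<D))) ⟩
      fromℤ (+ 2) * y * K - (V - y) - (V - y)    ∎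
    upper : T * D ≡ (X - ½) * D + (u + u)
    upper = begin
      T * (fromℤ (+ 2) * (V - y))                                  ≡⟨ solve (y ∷ K ∷ V ∷ T ∷ []) ℚ-ring ⟩
      fromℤ (+ 2) * y * K - (V - y) - (V - y)
        + ((V * (1ℚ + T) - y * (K + (1ℚ + T))) + (V * (1ℚ + T) - y * (K + (1ℚ + T)))) ≡⟨ cong (_+ (u + u)) shifted ⟨
      (X - ½) * D + (u + u)                                         ∎
    lower : (X - ½) * D ≡ (T - 1ℚ) * D + (l + l)
    lower = begin
      (X - ½) * D                                                  ≡⟨ shifted ⟩
      fromℤ (+ 2) * y * K - (V - y) - (V - y)                      ≡⟨ solve (y ∷ K ∷ V ∷ T ∷ []) ℚ-ring ⟩
      (T - 1ℚ) * (fromℤ (+ 2) * (V - y))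
        + ((y * (K + T) - T * V) + (y * (K + T) - T * V))           ∎

  round-xval : ∀ v k t y → y < ⟦ v ⟧ → ⟦ t ⟧ * ⟦ v ⟧ < y * (⟦ k ⟧ + ⟦ t ⟧) →
               y * (⟦ k ⟧ + (1ℚ + ⟦ t ⟧)) ≤ ⟦ v ⟧ * (1ℚ + ⟦ t ⟧) → round (xval v (+ k) (+ 0) y) ≡ + t
  round-xval v k t y y<v lower upper = ceiling-unique (+ t) (xval v (+ k) (+ 0) y - ½)
    (subst (λ x → ⟦ t ⟧ - 1ℚ < x - ½) (sym xval≡) (proj₁ bounds))
    (subst (λ x → x - ½ ≤ ⟦ t ⟧) (sym xval≡) (proj₂ bounds))
    where
    bounds = xval-rounding-bounds y ⟦ k ⟧ ⟦ v ⟧ ⟦ t ⟧ y<v lower upper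
    -- d = 0 enters xval as + k ℤ.- + 0, which reduces to + (k ℕ.+ 0).
    xval≡ : xval v (+ k) (+ 0) y ≡ (fromℤ (+ 2) * y * ⟦ k ⟧ - (⟦ v ⟧ - y)) /₀ (fromℤ (+ 2) * (⟦ v ⟧ - y))
    xval≡ = cong (λ n → (fromℤ (+ 2) * y * ⟦ n ⟧ - (⟦ v ⟧ - y)) /₀ (fromℤ (+ 2) * (⟦ v ⟧ - y)))
                 (ℕ.+-identityʳ k)

module Rounding (v k t : ℕ) (0<k : 0 ℕ.< k) (square< : (k ℕ.+ t) ℕ.* (k ℕ.+ t) ℕ.< v ℕ.* k) where

  open import Data.Nat using (suc; z≤n; s≤s; z<s)
  import Data.Nat.Properties as ℕ
  open import Data.Nat.DivMod using (_/_; _%_; m≡m%n+[m/n]*n; m%n<n)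
  open import Data.Integer as ℤ using (+_; -[1+_])
  open import Data.Rational as ℚ using (0ℚ; 1ℚ; _+_; _*_; _-_; _≤_; _<_; floor)
  open import Data.Rational.Properties
  open import Data.Product using (proj₁; proj₂)
  open import Relation.Binary.PropositionalEquality
  open import Data.List using (_∷_; [])
  open import Tactic.RingSolver using (solve)
  open Arithmetic using (quotient-bounds)
  open Rationals

  m = k ℕ.+ suc t
  V = ⟦ v ⟧
  K = ⟦ k ⟧
  T = ⟦ t ⟧
  M = K + (1ℚ + T)
  H₀ = h0 v k -[1+ t ]

  0<m : 0 ℕ.< m
  0<m = subst (0 ℕ.<_) (sym (ℕ.+-suc k t)) z<s

  instance
    _ : ℕ.NonZero m
    _ = ℕ.>-nonZero 0<m

  ⟦m⟧ : ⟦ m ⟧ ≡ M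
  ⟦m⟧ = trans (⟦⟧-+ k (suc t)) (cong (λ x → K + x) (⟦⟧-+ 1 t))

  ⟦v[1+t]⟧ : ⟦ v ℕ.* suc t ⟧ ≡ V * (1ℚ + T)
  ⟦v[1+t]⟧ = trans (⟦⟧-* v (suc t)) (cong (V *_) (⟦⟧-+ 1 t))

  0<M : 0ℚ < M
  0<M = subst (0ℚ <_) ⟦m⟧ (⟦⟧-mono-< 0<m)

  instance
    _ : ℚ.Positive M
    _ = ℚ.positive 0<M
    _ : ℚ.NonNegative M
    _ = ℚ.nonNegative (<⇒≤ 0<M)

  H₀M≡ : H₀ * M ≡ V * (1ℚ + T)
  H₀M≡ = subst₂ (λ a b → H₀ * a ≡ b) ⟦m⟧ ⟦v[1+t]⟧′
    (/₀-*-cancel _ ⟦ m ⟧ (≢-sym (<⇒≢ (⟦⟧-mono-< 0<m))))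
    where
    ⟦v[1+t]⟧′ : fromℤ (+ v ℤ.* + suc t) ≡ V * (1ℚ + T)
    ⟦v[1+t]⟧′ = trans (fromℤ-* (+ v) (+ suc t)) (cong (V *_) (⟦⟧-+ 1 t))

  h = (v ℕ.* suc t) / m
  r = (v ℕ.* suc t) % m

  division : r ℕ.+ h ℕ.* m ≡ v ℕ.* suc t
  division = sym (m≡m%n+[m/n]*n (v ℕ.* suc t) m)

  r<m : r ℕ.< m
  r<m = m%n<n (v ℕ.* suc t) m

  h+r<v : h ℕ.+ r ℕ.< v
  h+r<v = proj₁ (quotient-bounds h r square< division r<m)

  tv<h[k+t] : t ℕ.* v ℕ.< h ℕ.* (k ℕ.+ t)
  tv<h[k+t] = proj₂ (quotient-bounds h r square< division r<m)

  hm≤v[1+t] : h ℕ.* m ℕ.≤ v ℕ.* suc t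
  hm≤v[1+t] = subst (h ℕ.* m ℕ.≤_) division (ℕ.m≤n+m (h ℕ.* m) r)

  v[1+t]<[1+h]m : v ℕ.* suc t ℕ.< suc h ℕ.* m
  v[1+t]<[1+h]m = subst (ℕ._< suc h ℕ.* m) division (ℕ.+-monoˡ-< (h ℕ.* m) r<m)

  ⟦hm⟧ : ∀ h → ⟦ h ℕ.* m ⟧ ≡ ⟦ h ⟧ * M
  ⟦hm⟧ h = trans (⟦⟧-* h m) (cong (⟦ h ⟧ *_) ⟦m⟧)

  floor-H₀ : floor H₀ ≡ + h
  floor-H₀ = floor-unique (+ h) H₀
    (*-cancelʳ-≤-pos M (subst₂ _≤_ (⟦hm⟧ h) (trans ⟦v[1+t]⟧ (sym H₀M≡)) (⟦⟧-mono-≤ hm≤v[1+t])))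
    (*-cancelʳ-<-nonNeg M (subst₂ _<_ (trans ⟦v[1+t]⟧ (sym H₀M≡)) (⟦hm⟧ (suc h)) (⟦⟧-mono-< v[1+t]<[1+h]m)))

  h<v : h ℕ.< v
  h<v = ℕ.≤-trans (s≤s (ℕ.m≤m+n h r)) h+r<v

  TV<⟦h⟧[K+T] : T * V < ⟦ h ⟧ * (K + T)
  TV<⟦h⟧[K+T] = subst₂ _<_ (⟦⟧-* t v) (trans (⟦⟧-* h (k ℕ.+ t)) (cong (⟦ h ⟧ *_) (⟦⟧-+ k t)))
    (⟦⟧-mono-< tv<h[k+t])

  ⟦h⟧M≤V[1+T] : ⟦ h ⟧ * M ≤ V * (1ℚ + T)
  ⟦h⟧M≤V[1+T] = subst₂ _≤_ (⟦hm⟧ h) ⟦v[1+t]⟧ (⟦⟧-mono-≤ hm≤v[1+t])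

  round-xval-floor-H₀ : round (xval v (+ k) (+ 0) (fromℤ (floor H₀))) ≡ + t
  round-xval-floor-H₀ = subst (λ z → round (xval v (+ k) (+ 0) (fromℤ z)) ≡ + t) (sym floor-H₀)
    (round-xval v k t ⟦ h ⟧ (⟦⟧-mono-< h<v) TV<⟦h⟧[K+T] ⟦h⟧M≤V[1+T])

  H₀<V : H₀ < V
  H₀<V = *-cancelʳ-<-nonNeg M (subst (_< V * M) (sym H₀M≡) (*-monoʳ-<-pos V 1+T<M))
    where
    instance
      _ : ℚ.Positive V
      _ = ℚ.positive (⟦⟧-mono-< (ℕ.≤-<-trans z≤n h+r<v))
    1+T<M : 1ℚ + T < M
    1+T<M = subst₂ _<_ (⟦⟧-+ 1 t) ⟦m⟧ (⟦⟧-mono-< (ℕ.m<n+m (suc t) 0<k))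

  round-xval-H₀ : round (xval v (+ k) (+ 0) H₀) ≡ + t
  round-xval-H₀ = round-xval v k t H₀ H₀<V
    (<-by-gap (V - H₀) (0<q-p H₀<V) (h[K+T]≡TV+[V-h] H₀ K V T H₀M≡))
    (≤-reflexive H₀M≡)
    where
    h[K+T]≡TV+[V-h] : ∀ h K V T → h * (K + (1ℚ + T)) ≡ V * (1ℚ + T) → h * (K + T) ≡ T * V + (V - h)
    h[K+T]≡TV+[V-h] h K V T hM≡ = begin
      h * (K + T)               ≡⟨ solve (h ∷ K ∷ T ∷ []) ℚ-ring ⟩
      h * (K + (1ℚ + T)) - h    ≡⟨ cong (_- h) hM≡ ⟩
      V * (1ℚ + T) - h          ≡⟨ solve (V ∷ T ∷ h ∷ []) ℚ-ring ⟩
      T * V + (V - h)           ∎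
      where open ≡-Reasoning

  round-xval-floor-H₀≡round-xval-H₀ : round (xval v (+ k) (+ 0) (fromℤ (floor H₀))) ≡ round (xval v (+ k) (+ 0) H₀)
  round-xval-floor-H₀≡round-xval-H₀ = trans round-xval-floor-H₀ (sym round-xval-H₀)

open import Data.Nat using (_<_; suc; z≤n)
open import Data.Nat.Properties using (≤-<-trans)
open import Data.Integer as ℤ using (ℤ; +_)
open import Data.Rational using (floor)
open import Data.Product using (_,_; proj₁)
open import Relation.Binary.PropositionalEquality using (_≡_; subst; sym)
open WalkCounting using (module Neighbourhood)
open Eigenvalues using (restricted-parameters)
open Arithmetic using (k≡λ+1+[2+q]t; μc≡ak; [k+t]²<[k+1+c]k; μ+t<[1+q][1+t]+μ)

srg-[k+t]²<vk : ∀ {v k lam μ} {A : Graph v} → IsSRG v k lam μ A → ∀ q t →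
  k ≡ suc q ℕ.* suc t ℕ.+ μ → lam ℕ.+ suc t ≡ suc q ℕ.+ μ → (k ℕ.+ t) ℕ.* (k ℕ.+ t) ℕ.< v ℕ.* k
srg-[k+t]²<vk {v} {k} {lam} {μ} srg q t k≡ lam≡ =
  subst (λ w → (k ℕ.+ t) ℕ.* (k ℕ.+ t) ℕ.< w ℕ.* k) (sym vertexCount)
    ([k+t]²<[k+1+c]k μ t q farCount (subst (μ ℕ.+ t <_) (sym k≡) (μ+t<[1+q][1+t]+μ μ q t)) μc≡)
  where
  open Neighbourhood srg (proj₁ (IsSRG.notEdgeless srg))
  μc≡ : μ ℕ.* farCount ≡ (2 ℕ.+ q) ℕ.* t ℕ.* k
  μc≡ = μc≡ak μ ((2 ℕ.+ q) ℕ.* t) farCount walkCount (k≡λ+1+[2+q]t q t k≡ lam≡)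

corollary6p12 : (v k lam μ : ℕ) (A : Graph v) → IsSRG v k lam μ A →
    (ρ σ : ℤ) → IsRestrictedRoot k lam μ ρ → IsRestrictedRoot k lam μ σ → σ ℤ.< ρ →
    μ < k →
    round (xval v (+ k) (+ 0) (fromℤ (floor (h0 v k σ))))
      ≡ round (xval v (+ k) (+ 0) (h0 v k σ))
corollary6p12 v k lam μ A srg ρ σ fρ fσ σ<ρ μ<k =
  let q , t , σ≡ , k≡ , lam≡ = restricted-parameters fρ fσ σ<ρ μ<k
  in subst (λ s → round (xval v (+ k) (+ 0) (fromℤ (floor (h0 v k s)))) ≡ round (xval v (+ k) (+ 0) (h0 v k s)))
       (sym σ≡)
       (Rounding.round-xval-floor-H₀≡round-xval-H₀ v k t (≤-<-trans z≤n μ<k) (srg-[k+t]²<vk srg q t k≡ lam≡))
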